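{- Let $\alpha$ and $\beta$ be nonempty dotted compositions such that the last entry of $\alpha$ and the first entry of $\beta$ are both non-dotted, and let $m_\alpha,m_\beta$ be their fermionic degrees. Then $$S(L_{\alpha\odot\beta})=(-1)^{m_\alpha m_\beta}\,S(L_\beta)\bullet S(L_\alpha).$$
   Context: Variables: commuting $x_1,x_2,\dots$ and anticommuting $\theta_1,\theta_2,\dots$. A dotted composition is a finite sequence $\alpha=(\alpha_1,\dots,\alpha_l)$ with entries either positive integers (non-dotted) or dotted nonnegative integers $\dot0,\dot1,\dots$; $\ell(\alpha)=l$, $\eta_i=1$ if $\alpha_i$ dotted else $0$, and the fermionic degree $m_\alpha$ is the number of dotted entries. $M_\alpha=\sum_{i_1<\cdots<i_l}\theta_{i_1}^{\eta_1}\cdots\theta_{i_l}^{\eta_l}x_{i_1}^{\alpha_1}\cdots x_{i_l}^{\alpha_l}$, $M_\emptyset=1$, a basis of $\mathrm{sQSym}$. The order $\preccurlyeq$ is the reflexive–transitive closure of: $\beta\preccurlyeq\alpha$ if $\alpha$ is obtained from $\beta$ by replacing two adjacent non-dotted parts by their sum; $L_\alpha=\sum_{\beta\preccurlyeq\alpha}M_\beta$. Concatenation $\alpha\cdot\beta=(\alpha_1,\dots,\alpha_k,\beta_1,\dots,\beta_r)$; near concatenation (when $\alpha_k,\beta_1$ not both dotted) $\alpha\odot\beta=(\alpha_1,\dots,\alpha_{k-1},\alpha_k+\beta_1,\beta_2,\dots,\beta_r)$, middle entry dotted iff one of $\alpha_k,\beta_1$ is. The bilinear product $\bullet$ on $\mathrm{sQSym}$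 is $M_\gamma\bullet M_\delta=M_{\gamma\cdot\delta}$. $\mathrm{Rev}(\alpha)=(\alpha_l,\dots,\alpha_1)$. The order $\trianglelefteq$ is the reflexive–transitive closure of: $\beta\trianglelefteq\alpha$ if $\alpha$ is obtained from $\beta$ by replacing two adjacent parts, at most one dotted, by their sum (dotted iff one of them is); $\gamma\trianglerighteq\beta$ means $\beta\trianglelefteq\gamma$. The antipode $S$ of $\mathrm{sQSym}$ is the linear map with $S(M_\alpha)=(-1)^{\ell(\alpha)+\binom{m_\alpha}{2}}\sum_{\gamma\trianglerighteq\mathrm{Rev}(\alpha)}M_\gamma$. -}

module Defs where

open import Data.Nat as ℕ using (ℕ; zero; suc)
open import Data.Nat.Combinatorics using (_C_)
open import Data.Integer as ℤ using (ℤ; 1ℤ)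
open import Data.List using (List; []; _∷_; [_]; _++_; map; concatMap; length; reverse; filter; deduplicate)
open import Data.Nat.ListAction using (sum)
open import Data.List.Properties using (≡-dec)
open import Data.Maybe using (Maybe; just; nothing)
open import Data.Product using (_×_; _,_)
open import Relation.Binary.PropositionalEquality using (_≡_; refl; cong)
open import Relation.Binary.Definitions using (DecidableEquality)
open import Relation.Nullary using (yes; no)

-- Dotted compositions
--   nd k : the non-dotted entry with value k+1  (positive integers)
--   dt k : the dotted entry  k̇ with value k     (k ≥ 0)

data Entry : Set where
  nd : ℕ → Entry
  dt : ℕ → Entry

DComp : Set
DComp = List Entry

nd-inj : ∀ {a b} → nd a ≡ nd b → a ≡ b
nd-inj refl = refl

dt-inj : ∀ {a b} → dt a ≡ dt b → a ≡ b
dt-inj refl = refl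

_≟E_ : DecidableEquality Entry
nd a ≟E nd b with a ℕ.≟ b
... | yes refl = yes refl
... | no ne = no (λ e → ne (nd-inj e))
nd a ≟E dt b = no (λ ())
dt a ≟E nd b = no (λ ())
dt a ≟E dt b with a ℕ.≟ b
... | yes refl = yes refl
... | no ne = no (λ e → ne (dt-inj e))

_≟D_ : DecidableEquality DComp
_≟D_ = ≡-dec _≟E_

isDotted : Entry → ℕ
isDotted (nd _) = 0
isDotted (dt _) = 1

fdeg : DComp → ℕ
fdeg α = sum (map isDotted α)

addE : Entry → Entry → Maybe Entry
addE (nd a) (nd b) = just (nd (suc (a ℕ.+ b)))     -- (a+1)+(b+1) = (a+b+1)+1
addE (nd a) (dt b) = just (dt (suc a ℕ.+ b))
addE (dt a) (nd b) = just (dt (a ℕ.+ suc b))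
addE (dt _) (dt _) = nothing

-- near concatenation α ⊙ β (only meaningful when the last entry of α and
-- the first entry of β are not both dotted; the theorem only uses it then)
joinLast : DComp → Entry → DComp
joinLast [] b = [ b ]
joinLast (a ∷ []) b with addE a b
... | just c = [ c ]
... | nothing = a ∷ b ∷ []
joinLast (a ∷ a' ∷ as) b = a ∷ joinLast (a' ∷ as) b

_⊙_ : DComp → DComp → DComp
α ⊙ [] = α
α ⊙ (b ∷ bs) = joinLast α b ++ bs

-- Enumeration of {β | β ≼ α}: β arises from α by splitting each
-- non-dotted part into a composition (non-dotted positive parts);
-- dotted parts are kept.

-- all compositions of k+1 into non-dotted positive parts
bump : DComp → DComp
bump (nd j ∷ r) = nd (suc j) ∷ r
bump c = c

splits : ℕ → List DComp
splits zero = [ [ nd 0 ] ]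
splits (suc k) = concatMap (λ c → (nd 0 ∷ c) ∷ bump c ∷ []) (splits k)

refinements : DComp → List DComp
refinements [] = [ [] ]
refinements (nd k ∷ r) =
  concatMap (λ s → map (s ++_) (refinements r)) (splits k)
refinements (dt k ∷ r) = map (dt k ∷_) (refinements r)

belowL : DComp → List DComp
belowL α = deduplicate _≟D_ (refinements α)

-- Enumeration of {γ | γ ⊵ δ}: merge contiguous blocks each containing
-- at most one dotted part.

mergeHead : Entry → DComp → List DComp
mergeHead e [] = []
mergeHead e (f ∷ c) with addE e f
... | just g = [ g ∷ c ]
... | nothing = []

coarsenings : DComp → List DComp
coarsenings [] = [ [] ]
coarsenings (e ∷ r) =
  concatMap (λ c → (e ∷ c) ∷ mergeHead e c) (coarsenings r)

aboveT : DComp → List DComp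
aboveT δ = deduplicate _≟D_ (coarsenings δ)

-- sQSym (over ℤ) as formal ℤ-linear combinations of the basis M_α.

SQSym : Set
SQSym = List (ℤ × DComp)

M : DComp → SQSym
M α = [ (1ℤ , α) ]

coeff : DComp → SQSym → ℤ
coeff γ [] = ℤ.0ℤ
coeff γ ((c , δ) ∷ xs) with δ ≟D γ
... | yes _ = c ℤ.+ coeff γ xs
... | no _ = coeff γ xs

infix 4 _≈_
_≈_ : SQSym → SQSym → Set
x ≈ y = ∀ γ → coeff γ x ≡ coeff γ y

scale : ℤ → SQSym → SQSym
scale a = map (λ { (c , δ) → (a ℤ.* c , δ) })

infixl 7 _•_
_•_ : SQSym → SQSym → SQSym
x • y = concatMap (λ { (a , γ) → map (λ { (b , δ) → (a ℤ.* b , γ ++ δ) }) y }) x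

sgn : ℕ → ℤ
sgn n = ℤ.-1ℤ ℤ.^ n

L : DComp → SQSym
L α = map (λ β → (1ℤ , β)) (belowL α)

SM : DComp → SQSym
SM α = map (λ γ → (sgn (length α ℕ.+ (fdeg α C 2)) , γ)) (aboveT (reverse α))

S : SQSym → SQSym
S x = concatMap (λ { (c , α) → scale c (SM α) }) x

{-# OPTIONS --safe #-}
-- Write R(α) for the list of refinements β ≼ α and C(δ) for the list of coarsenings γ ⊵ δ, so that
-- S(L_α) = Σ_{a ∈ R(α)} S(M_a) and S(M_a) = ± Σ_{γ ∈ C(Rev a)} M_γ. The merged part of α ⊙ β is
-- either cut at the junction or not, so R(α ⊙ β) consists of the a·b and the a ⊙ b with a ∈ R(α),
-- b ∈ R(β). Dually, two adjacent non-dotted parts of Rev(a·b) are either kept apart or merged, so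
-- C(Rev(a·b)) consists of C(Rev b)·C(Rev a) and C(Rev(a ⊙ b)). Since ℓ(a·b) = ℓ(a ⊙ b) + 1, the
-- second family cancels S(M_{a⊙b}), leaving S(M_{a·b}) + S(M_{a⊙b}) = (-1)^{m_a m_b} S(M_b) • S(M_a);
-- the sign comes from binom(m_a + m_b, 2) = binom(m_a, 2) + binom(m_b, 2) + m_a m_b. Elements of sQSym are compared coefficientwise, so all enumerations are
-- handled up to permutation, and the deduplications in L and S are harmless because the
-- enumerations have no repetitions.
module Submission where

open import Defs
open import Data.Nat as ℕ using (ℕ; zero; suc; _*_)
import Data.Nat.Properties as ℕ
open import Data.List using (List; []; _∷_; [_]; _++_; _∷ʳ_; map; concatMap; length; reverse; deduplicate)
open import Data.List.Properties
  using (++-assoc; ++-identityʳ; map-++; map-∘; map-cong; map-cong-local; map-id; concatMap-++; concatMap-map; map-concatMap;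
         concatMap-cong; filter-all; length-++; length-++-sucʳ; reverse-++; unfold-reverse; ∷-injective; ∷-injectiveʳ; ++-cancelˡ)
open import Data.List.Relation.Binary.Permutation.Propositional
open import Data.List.Relation.Binary.Permutation.Propositional.Properties using (++⁺ˡ; ++⁺ʳ; ++⁺; shifts; map⁺)
open import Data.List.Relation.Unary.All as All using (All; []; _∷_)
import Data.List.Relation.Unary.All.Properties as All
open import Data.List.Relation.Unary.AllPairs using ([]; _∷_)
open import Data.List.Relation.Unary.Any using (here; there)
open import Data.List.Relation.Unary.Unique.Propositional using (Unique)
import Data.List.Relation.Unary.Unique.Propositional.Properties as Unique
open import Data.List.Membership.Propositional using (_∈_; find)
open import Data.List.Membership.Propositional.Properties using (∈-concatMap⁻; ∈-map⁻)
open import Data.Product using (_×_; _,_; proj₁)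
open import Data.Empty using (⊥; ⊥-elim)
open import Data.Unit using (tt)
open import Data.Maybe using (just; nothing)
open import Data.Maybe.Properties using (just-injective)
open import Relation.Binary.PropositionalEquality as ≡ using (_≡_; _≢_; refl; cong; cong₂; module ≡-Reasoning)
open import Relation.Binary.Definitions using (DecidableEquality)
open import Relation.Binary.Bundles using (Setoid)
import Relation.Binary.Reasoning.Setoid as SetoidReasoning
open import Relation.Nullary using (yes; no)
open import Level using (0ℓ)
open import Data.Integer as ℤ using (ℤ; 1ℤ; 0ℤ; -1ℤ; _+_)
import Data.Integer.Properties as ℤ
open import Data.Integer.Tactic.RingSolver using (solve-∀)
import Data.Nat.Tactic.RingSolver as ℕ-Solver
open import Data.Nat.Combinatorics using (_C_; nC1≡n; nCk+nC[k+1]≡[n+1]C[k+1])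
open import Algebra.Properties.CommutativeSemigroup ℤ.+-commutativeSemigroup using (x∙yz≈y∙xz)

-- Lists up to permutation

module _ {A B : Set} where

  concatMap-↭ : (f : A → List B) {xs ys : List A} → xs ↭ ys → concatMap f xs ↭ concatMap f ys
  concatMap-↭ f refl = ↭-refl
  concatMap-↭ f (prep x p) = ++⁺ˡ (f x) (concatMap-↭ f p)
  concatMap-↭ f (swap x y p) = ↭-trans (shifts (f x) (f y)) (++⁺ˡ (f y) (++⁺ˡ (f x) (concatMap-↭ f p)))
  concatMap-↭ f (trans p q) = ↭-trans (concatMap-↭ f p) (concatMap-↭ f q)

  concatMap-cong-↭ : {f g : A → List B} (xs : List A) → All (λ x → f x ↭ g x) xs → concatMap f xs ↭ concatMap g xs
  concatMap-cong-↭ [] [] = ↭-refl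
  concatMap-cong-↭ (x ∷ xs) (p ∷ ps) = ++⁺ p (concatMap-cong-↭ xs ps)

  concatMap-cong-local : {f g : A → List B} {xs : List A} → All (λ x → f x ≡ g x) xs → concatMap f xs ≡ concatMap g xs
  concatMap-cong-local [] = refl
  concatMap-cong-local (p ∷ ps) = cong₂ _++_ p (concatMap-cong-local ps)

  concatMap-++-↭ : (f g : A → List B) (xs : List A) →
    concatMap (λ x → f x ++ g x) xs ↭ concatMap f xs ++ concatMap g xs
  concatMap-++-↭ f g [] = ↭-refl
  concatMap-++-↭ f g (x ∷ xs) = begin
    (f x ++ g x) ++ concatMap (λ x → f x ++ g x) xs   ≡⟨ ++-assoc (f x) (g x) _ ⟩
    f x ++ g x ++ concatMap (λ x → f x ++ g x) xs     ↭⟨ ++⁺ˡ (f x) (++⁺ˡ (g x) (concatMap-++-↭ f g xs)) ⟩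
    f x ++ g x ++ concatMap f xs ++ concatMap g xs    ↭⟨ ++⁺ˡ (f x) (shifts (g x) (concatMap f xs)) ⟩
    f x ++ concatMap f xs ++ g x ++ concatMap g xs    ≡⟨ ++-assoc (f x) (concatMap f xs) _ ⟨
    (f x ++ concatMap f xs) ++ g x ++ concatMap g xs  ∎
    where open PermutationReasoning

  concatMap-const-[] : (xs : List A) → concatMap {B = B} (λ _ → []) xs ≡ []
  concatMap-const-[] [] = refl
  concatMap-const-[] (x ∷ xs) = concatMap-const-[] xs

  concatMap-[_] : (f : A → B) (xs : List A) → concatMap (λ x → [ f x ]) xs ≡ map f xs
  concatMap-[ f ] [] = refl
  concatMap-[ f ] (x ∷ xs) = cong (f x ∷_) (concatMap-[ f ] xs)

  concatMap-∷-↭ : (f : A → B) (g : A → List B) (xs : List A) →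
    concatMap (λ x → f x ∷ g x) xs ↭ map f xs ++ concatMap g xs
  concatMap-∷-↭ f g xs = ↭-trans (concatMap-++-↭ (λ x → [ f x ]) g xs)
    (↭-reflexive (cong (_++ concatMap g xs) (concatMap-[ f ] xs)))

  concatMap-pair-↭ : (f g : A → B) (xs : List A) →
    concatMap (λ x → f x ∷ g x ∷ []) xs ↭ map f xs ++ map g xs
  concatMap-pair-↭ f g xs = ↭-trans (concatMap-∷-↭ f (λ x → [ g x ]) xs)
    (↭-reflexive (cong (map f xs ++_) (concatMap-[ g ] xs)))

  All-concatMap⁺ : {P : A → Set} {Q : B → Set} {f : A → List B} {xs : List A} →
    (∀ {x} → P x → All Q (f x)) → All P xs → All Q (concatMap f xs)
  All-concatMap⁺ h [] = []
  All-concatMap⁺ h (px ∷ pxs) = All.++⁺ (h px) (All-concatMap⁺ h pxs)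

  unique-concatMap : (f : A → List B) {xs : List A} → Unique xs → All (λ x → Unique (f x)) xs →
    (∀ {x y b} → x ∈ xs → y ∈ xs → b ∈ f x → b ∈ f y → x ≡ y) → Unique (concatMap f xs)
  unique-concatMap f {[]} _ _ _ = []
  unique-concatMap f {x ∷ xs} (x∉ ∷ u) (ux ∷ us) fibre =
    Unique.++⁺ ux (unique-concatMap f u us (λ p q → fibre (there p) (there q))) disjoint
    where
    disjoint : ∀ {b} → b ∈ f x × b ∈ concatMap f xs → ⊥
    disjoint (b∈fx , b∈rest) with find (∈-concatMap⁻ f b∈rest)
    ... | y , y∈xs , b∈fy = All.lookup x∉ y∈xs (fibre (here refl) (there y∈xs) b∈fx b∈fy)

module _ {A B C : Set} where

  concatMap-concatMap : (g : B → List C) (f : A → List B) (xs : List A) →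
    concatMap g (concatMap f xs) ≡ concatMap (λ x → concatMap g (f x)) xs
  concatMap-concatMap g f [] = refl
  concatMap-concatMap g f (x ∷ xs) =
    ≡.trans (concatMap-++ g (f x) _) (cong (concatMap g (f x) ++_) (concatMap-concatMap g f xs))

  concatMap-comm : (F : A → B → List C) (xs : List A) (ys : List B) →
    concatMap (λ x → concatMap (F x) ys) xs ↭ concatMap (λ y → concatMap (λ x → F x y) xs) ys
  concatMap-comm F [] ys = ↭-reflexive (≡.sym (concatMap-const-[] ys))
  concatMap-comm F (x ∷ xs) ys = ↭-trans (++⁺ˡ (concatMap (F x) ys) (concatMap-comm F xs ys))
    (↭-sym (concatMap-++-↭ (F x) (λ y → concatMap (λ x → F x y) xs) ys))

  -- cartesianProductWith, in the concatMap form used by refinements in Defs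
  productWith : (A → B → C) → List A → List B → List C
  productWith op xs ys = concatMap (λ x → map (op x) ys) xs

deduplicate-unique : ∀ {A : Set} (_≟_ : DecidableEquality A) {xs : List A} →
  Unique xs → deduplicate _≟_ xs ≡ xs
deduplicate-unique _≟_ {[]} _ = refl
deduplicate-unique _≟_ {x ∷ xs} (x∉ ∷ u) rewrite deduplicate-unique _≟_ u = cong (x ∷_) (filter-all _ x∉)

module _ {A B C : Set} where

  All-productWith : {P : A → Set} {Q : B → Set} {R : C → Set} {f : A → B → C} {xs : List A} {ys : List B} →
    (∀ {x y} → P x → Q y → R (f x y)) → All P xs → All Q ys → All R (productWith f xs ys)
  All-productWith h pxs qys = All-concatMap⁺ (λ px → All.map⁺ (All.map (h px) qys)) pxs

  productWith-++ˡ : (f : A → B → C) (xs xs′ : List A) (ys : List B) →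
    productWith f (xs ++ xs′) ys ≡ productWith f xs ys ++ productWith f xs′ ys
  productWith-++ˡ f xs xs′ ys = concatMap-++ (λ x → map (f x) ys) xs xs′

  productWith-++ʳ : (f : A → B → C) (xs : List A) (ys ys′ : List B) →
    productWith f xs (ys ++ ys′) ↭ productWith f xs ys ++ productWith f xs ys′
  productWith-++ʳ f xs ys ys′ = ↭-trans
    (↭-reflexive (concatMap-cong (λ x → map-++ (f x) ys ys′) xs))
    (concatMap-++-↭ (λ x → map (f x) ys) (λ x → map (f x) ys′) xs)

  productWith-↭ˡ : (f : A → B → C) {xs xs′ : List A} (ys : List B) →
    xs ↭ xs′ → productWith f xs ys ↭ productWith f xs′ ys
  productWith-↭ˡ f ys = concatMap-↭ (λ x → map (f x) ys)

  productWith-↭ʳ : (f : A → B → C) (xs : List A) {ys ys′ : List B} →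
    ys ↭ ys′ → productWith f xs ys ↭ productWith f xs ys′
  productWith-↭ʳ f xs p = concatMap-cong-↭ xs (All.tabulate (λ {x} _ → map⁺ (f x) p))

  concatMap-productWith-++ : {D : Set} (h : C → List D) (f g : A → B → C) (xs : List A) (ys : List B) →
    concatMap h (productWith f xs ys ++ productWith g xs ys) ↭
    concatMap (λ x → concatMap (λ y → h (f x y) ++ h (g x y)) ys) xs
  concatMap-productWith-++ h f g xs ys = begin
    concatMap h (productWith f xs ys ++ productWith g xs ys)
      ≡⟨ concatMap-++ h (productWith f xs ys) _ ⟩
    concatMap h (productWith f xs ys) ++ concatMap h (productWith g xs ys)
      ≡⟨ cong₂ _++_ (expand f) (expand g) ⟩
    concatMap (λ x → concatMap (λ y → h (f x y)) ys) xs ++ concatMap (λ x → concatMap (λ y → h (g x y)) ys) xs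
      ↭⟨ concatMap-++-↭ _ _ xs ⟨
    concatMap (λ x → concatMap (λ y → h (f x y)) ys ++ concatMap (λ y → h (g x y)) ys) xs
      ↭⟨ concatMap-cong-↭ xs (All.tabulate (λ {x} _ → ↭-sym (concatMap-++-↭ (λ y → h (f x y)) (λ y → h (g x y)) ys))) ⟩
    concatMap (λ x → concatMap (λ y → h (f x y) ++ h (g x y)) ys) xs ∎
    where
    open PermutationReasoning
    expand : (op : A → B → C) → concatMap h (productWith op xs ys) ≡ concatMap (λ x → concatMap (λ y → h (op x y)) ys) xs
    expand op = ≡.trans (concatMap-concatMap h (λ x → map (op x) ys) xs)
                        (concatMap-cong (λ x → concatMap-map h (op x) ys) xs)

module _ {A B : Set} where

  concatMap-productWith : (h : A → List A) (f : A → B → A) {xs : List A} {ys : List B} →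
    All (λ x → concatMap (λ y → h (f x y)) ys ↭ productWith f (h x) ys) xs →
    concatMap h (productWith f xs ys) ↭ productWith f (concatMap h xs) ys
  concatMap-productWith h f {xs} {ys} hyp = begin
    concatMap h (productWith f xs ys)                              ≡⟨ concatMap-concatMap h (λ x → map (f x) ys) xs ⟩
    concatMap (λ x → concatMap h (map (f x) ys)) xs                ≡⟨ concatMap-cong (λ x → concatMap-map h (f x) ys) xs ⟩
    concatMap (λ x → concatMap (λ y → h (f x y)) ys) xs            ↭⟨ concatMap-cong-↭ xs hyp ⟩
    concatMap (λ x → productWith f (h x) ys) xs                    ≡⟨ concatMap-concatMap (λ x → map (f x) ys) h xs ⟨
    productWith f (concatMap h xs) ys                              ∎
    where open PermutationReasoning

module _ {A B C D E F : Set} where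

  productWith-assoc : {f : D → C → F} {g : A → B → D} {f′ : B → C → E} {g′ : A → E → F}
    (xs : List A) {ys : List B} (zs : List C) →
    All (λ y → ∀ x z → f (g x y) z ≡ g′ x (f′ y z)) ys →
    productWith f (productWith g xs ys) zs ≡ productWith g′ xs (productWith f′ ys zs)
  productWith-assoc {f} {g} {f′} {g′} xs {ys} zs hyp = begin
    productWith f (productWith g xs ys) zs
      ≡⟨ concatMap-concatMap (λ w → map (f w) zs) (λ x → map (g x) ys) xs ⟩
    concatMap (λ x → concatMap (λ w → map (f w) zs) (map (g x) ys)) xs
      ≡⟨ concatMap-cong (λ x → concatMap-map (λ w → map (f w) zs) (g x) ys) xs ⟩
    concatMap (λ x → concatMap (λ y → map (f (g x y)) zs) ys) xs
      ≡⟨ concatMap-cong (λ x → concatMap-cong-local (All.map (λ h → ≡.trans (map-cong (h x) zs) (map-∘ zs)) hyp)) xs ⟩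
    concatMap (λ x → concatMap (λ y → map (g′ x) (map (f′ y) zs)) ys) xs
      ≡⟨ concatMap-cong (λ x → map-concatMap (g′ x) (λ y → map (f′ y) zs) ys) xs ⟨
    productWith g′ xs (productWith f′ ys zs) ∎
    where open ≡-Reasoning

productWith-++-[[]] : {A : Set} (xs : List (List A)) → productWith _++_ xs [ [] ] ≡ xs
productWith-++-[[]] xs = ≡.trans (concatMap-[ (λ x → x ++ []) ] xs) (≡.trans (map-cong ++-identityʳ xs) (map-id xs))

PrefixFree : {A : Set} → List (List A) → Set
PrefixFree xs = ∀ {s s′} → s ∈ xs → s′ ∈ xs → ∀ t t′ → s ++ t ≡ s′ ++ t′ → s ≡ s′

unique-productWith-++ : {A : Set} {xs ys : List (List A)} →
  Unique xs → PrefixFree xs → Unique ys → Unique (productWith _++_ xs ys)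
unique-productWith-++ {xs = xs} {ys} uxs pf uys = unique-concatMap (λ s → map (s ++_) ys) uxs
  (All.tabulate (λ {s} _ → Unique.map⁺ (++-cancelˡ s _ _) uys)) fibre
  where
  fibre : ∀ {s s′ b} → s ∈ xs → s′ ∈ xs → b ∈ map (s ++_) ys → b ∈ map (s′ ++_) ys → s ≡ s′
  fibre s∈ s′∈ b∈ b∈′ with ∈-map⁻ _ b∈ | ∈-map⁻ _ b∈′
  ... | t , _ , refl | t′ , _ , eq = pf s∈ s′∈ t t′ eq

-- Refinements and near concatenation

data NonEmpty : DComp → Set where
  nonEmpty : ∀ e s → NonEmpty (e ∷ s)

data StartsND : DComp → Set where
  startsND : ∀ a s → StartsND (nd a ∷ s)

data EndsND : DComp → Set where
  endsND : ∀ s a → EndsND (s ∷ʳ nd a)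

startsND⇒nonEmpty : ∀ {s} → StartsND s → NonEmpty s
startsND⇒nonEmpty (startsND a s) = nonEmpty (nd a) s

endsND⇒nonEmpty : ∀ {s} → EndsND s → NonEmpty s
endsND⇒nonEmpty (endsND [] a) = nonEmpty (nd a) []
endsND⇒nonEmpty (endsND (e ∷ s) a) = nonEmpty e (s ∷ʳ nd a)

⊙-nd : ∀ xs p q ys → (xs ∷ʳ nd p) ⊙ (nd q ∷ ys) ≡ xs ++ nd (suc (p ℕ.+ q)) ∷ ys
⊙-nd xs p q ys = ≡.trans (cong (_++ ys) (joinLast-nd xs)) (++-assoc xs _ ys)
  where
  joinLast-nd : ∀ xs → joinLast (xs ∷ʳ nd p) (nd q) ≡ xs ∷ʳ nd (suc (p ℕ.+ q))
  joinLast-nd [] = refl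
  joinLast-nd (x ∷ []) = refl
  joinLast-nd (x ∷ y ∷ xs) = cong (x ∷_) (joinLast-nd (y ∷ xs))

∷-⊙ : ∀ x {s} t → NonEmpty s → (x ∷ s) ⊙ t ≡ x ∷ (s ⊙ t)
∷-⊙ x [] (nonEmpty e s) = refl
∷-⊙ x (b ∷ t) (nonEmpty e s) = refl

++-⊙ : ∀ s {a} t → NonEmpty a → (s ++ a) ⊙ t ≡ s ++ (a ⊙ t)
++-⊙ [] t ne = refl
++-⊙ (x ∷ s) {a} t ne = ≡.trans (∷-⊙ x t (++-nonEmpty s ne)) (cong (x ∷_) (++-⊙ s t ne))
  where
  ++-nonEmpty : ∀ s → NonEmpty a → NonEmpty (s ++ a)
  ++-nonEmpty [] ne = ne
  ++-nonEmpty (y ∷ s) _ = nonEmpty y (s ++ a)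

⊙-++ : ∀ s {t} r → NonEmpty t → (s ⊙ t) ++ r ≡ s ⊙ (t ++ r)
⊙-++ s r (nonEmpty b t) = ++-assoc (joinLast s b) t r

bump-⊙ : ∀ {s t} → StartsND s → StartsND t → bump s ⊙ t ≡ bump (s ⊙ t)
bump-⊙ (startsND a []) (startsND b t) = refl
bump-⊙ (startsND a (x ∷ s)) (startsND b t) = refl

bump-++ : ∀ {s} r → NonEmpty s → bump (s ++ r) ≡ bump s ++ r
bump-++ r (nonEmpty (nd a) s) = refl
bump-++ r (nonEmpty (dt a) s) = refl

grow : DComp → List DComp
grow c = (nd 0 ∷ c) ∷ bump c ∷ []

splits-startsND : ∀ k → All StartsND (splits k)
splits-startsND zero = startsND 0 [] ∷ []
splits-startsND (suc k) = All-concatMap⁺ grow-startsND (splits-startsND k)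
  where
  grow-startsND : ∀ {c} → StartsND c → All StartsND (grow c)
  grow-startsND (startsND a c) = startsND 0 (nd a ∷ c) ∷ startsND (suc a) c ∷ []

splits-endsND : ∀ k → All EndsND (splits k)
splits-endsND zero = endsND [] 0 ∷ []
splits-endsND (suc k) = All-concatMap⁺ grow-endsND (splits-endsND k)
  where
  grow-endsND : ∀ {c} → EndsND c → All EndsND (grow c)
  grow-endsND (endsND [] a) = endsND [ nd 0 ] a ∷ endsND [] (suc a) ∷ []
  grow-endsND (endsND (nd b ∷ s) a) = endsND (nd 0 ∷ nd b ∷ s) a ∷ endsND (nd (suc b) ∷ s) a ∷ []
  grow-endsND (endsND (dt b ∷ s) a) = endsND (nd 0 ∷ dt b ∷ s) a ∷ endsND (dt b ∷ s) a ∷ []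

splits-fdeg : ∀ k → All (λ s → fdeg s ≡ 0) (splits k)
splits-fdeg zero = refl ∷ []
splits-fdeg (suc k) = All-concatMap⁺ (λ {c} e → e ∷ ≡.trans (fdeg-bump c) e ∷ []) (splits-fdeg k)
  where
  fdeg-bump : ∀ c → fdeg (bump c) ≡ fdeg c
  fdeg-bump [] = refl
  fdeg-bump (nd a ∷ c) = refl
  fdeg-bump (dt a ∷ c) = refl

grow-productWith : (op : DComp → DComp → DComp) →
  (∀ {s t} → StartsND s → StartsND t → op (nd 0 ∷ s) t ≡ nd 0 ∷ op s t) →
  (∀ {s t} → StartsND s → StartsND t → op (bump s) t ≡ bump (op s t)) →
  ∀ {xs ys} → All StartsND xs → All StartsND ys →
  concatMap grow (productWith op xs ys) ↭ productWith op (concatMap grow xs) ys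
grow-productWith op op-nd0 op-bump {ys = ys} sxs sys = concatMap-productWith grow op (All.map grow-op sxs)
  where
  grow-op : ∀ {s} → StartsND s → concatMap (λ t → grow (op s t)) ys ↭ productWith op (grow s) ys
  grow-op {s} ss = begin
    concatMap (λ t → grow (op s t)) ys
      ↭⟨ concatMap-pair-↭ (λ t → nd 0 ∷ op s t) (λ t → bump (op s t)) ys ⟩
    map (λ t → nd 0 ∷ op s t) ys ++ map (λ t → bump (op s t)) ys
      ≡⟨ cong₂ _++_ (map-cong-local (All.map (op-nd0 ss) sys)) (map-cong-local (All.map (op-bump ss) sys)) ⟨
    map (op (nd 0 ∷ s)) ys ++ map (op (bump s)) ys
      ≡⟨ cong (map (op (nd 0 ∷ s)) ys ++_) (++-identityʳ _) ⟨
    productWith op (grow s) ys ∎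
    where open PermutationReasoning

splits-⊙ : ∀ k j → splits (suc (k ℕ.+ j)) ↭
  productWith _++_ (splits k) (splits j) ++ productWith _⊙_ (splits k) (splits j)
splits-⊙ zero j = begin
  concatMap grow (splits j)
    ↭⟨ concatMap-pair-↭ (nd 0 ∷_) bump (splits j) ⟩
  map (nd 0 ∷_) (splits j) ++ map bump (splits j)
    ≡⟨ cong (map (nd 0 ∷_) (splits j) ++_) (map-cong-local (All.map (λ { (startsND b t) → refl }) (splits-startsND j))) ⟩
  map ([ nd 0 ] ++_) (splits j) ++ map ([ nd 0 ] ⊙_) (splits j)
    ≡⟨ cong₂ _++_ (++-identityʳ (map ([ nd 0 ] ++_) (splits j))) (++-identityʳ (map ([ nd 0 ] ⊙_) (splits j))) ⟨
  productWith _++_ [ [ nd 0 ] ] (splits j) ++ productWith _⊙_ [ [ nd 0 ] ] (splits j) ∎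
  where open PermutationReasoning
splits-⊙ (suc k) j = begin
  concatMap grow (splits (suc (k ℕ.+ j)))
    ↭⟨ concatMap-↭ grow (splits-⊙ k j) ⟩
  concatMap grow (productWith _++_ Sk Sj ++ productWith _⊙_ Sk Sj)
    ≡⟨ concatMap-++ grow (productWith _++_ Sk Sj) _ ⟩
  concatMap grow (productWith _++_ Sk Sj) ++ concatMap grow (productWith _⊙_ Sk Sj)
    ↭⟨ ++⁺ (grow-productWith _++_ (λ _ _ → refl) (λ ss _ → ≡.sym (bump-++ _ (startsND⇒nonEmpty ss))) sSk sSj)
           (grow-productWith _⊙_ (λ {_} {t} ss _ → ∷-⊙ (nd 0) t (startsND⇒nonEmpty ss)) bump-⊙ sSk sSj) ⟩
  productWith _++_ (splits (suc k)) Sj ++ productWith _⊙_ (splits (suc k)) Sj ∎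
  where
  open PermutationReasoning
  Sk Sj : List DComp
  Sk = splits k
  Sj = splits j
  sSk : All StartsND Sk
  sSk = splits-startsND k
  sSj : All StartsND Sj
  sSj = splits-startsND j

fdeg-++ : ∀ x y → fdeg (x ++ y) ≡ fdeg x ℕ.+ fdeg y
fdeg-++ [] y = refl
fdeg-++ (e ∷ x) y = ≡.trans (cong (isDotted e ℕ.+_) (fdeg-++ x y)) (≡.sym (ℕ.+-assoc (isDotted e) _ _))

entryRefinements : Entry → List DComp
entryRefinements (nd k) = splits k
entryRefinements (dt k) = [ [ dt k ] ]

refinements-∷ : ∀ e r → refinements (e ∷ r) ≡ productWith _++_ (entryRefinements e) (refinements r)
refinements-∷ (nd k) r = refl
refinements-∷ (dt k) r = ≡.sym (++-identityʳ _)

refinements-[nd] : ∀ k → refinements [ nd k ] ≡ splits k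
refinements-[nd] k = productWith-++-[[]] (splits k)

refinements-fdeg : ∀ α → All (λ β → fdeg β ≡ fdeg α) (refinements α)
refinements-fdeg [] = refl ∷ []
refinements-fdeg (e ∷ r) rewrite refinements-∷ e r =
  All-productWith (λ {s} {t} fs ft → ≡.trans (fdeg-++ s t) (cong₂ ℕ._+_ fs ft)) (entry-fdeg e) (refinements-fdeg r)
  where
  entry-fdeg : ∀ e → All (λ s → fdeg s ≡ isDotted e) (entryRefinements e)
  entry-fdeg (nd k) = splits-fdeg k
  entry-fdeg (dt k) = refl ∷ []

refinements-endsND : ∀ xs k → All EndsND (refinements (xs ∷ʳ nd k))
refinements-endsND [] k rewrite refinements-[nd] k = splits-endsND k
refinements-endsND (e ∷ xs) k rewrite refinements-∷ e (xs ∷ʳ nd k) =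
  All-productWith (λ {s} _ → ++-endsND s) (All.universal (λ _ → tt) (entryRefinements e)) (refinements-endsND xs k)
  where
  ++-endsND : ∀ s {t} → EndsND t → EndsND (s ++ t)
  ++-endsND s (endsND t a) = ≡.subst EndsND (++-assoc s t _) (endsND (s ++ t) a)

refinements-startsND : ∀ j ys → All StartsND (refinements (nd j ∷ ys))
refinements-startsND j ys =
  All-productWith (λ { (startsND a s) _ → startsND a (s ++ _) }) (splits-startsND j) (All.universal (λ _ → tt) (refinements ys))

refinements-⊙ : ∀ xs k j ys →
  let Rα = refinements (xs ∷ʳ nd k)
      Rβ = refinements (nd j ∷ ys)
  in refinements ((xs ∷ʳ nd k) ⊙ (nd j ∷ ys)) ↭ productWith _++_ Rα Rβ ++ productWith _⊙_ Rα Rβ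
refinements-⊙ xs k j ys rewrite ⊙-nd xs k j ys = merged xs
  where
  open PermutationReasoning
  Rβ Rys : List DComp
  Rβ = refinements (nd j ∷ ys)
  Rys = refinements ys
  merged : ∀ xs → let Rα = refinements (xs ∷ʳ nd k) in
    refinements (xs ++ nd (suc (k ℕ.+ j)) ∷ ys) ↭ productWith _++_ Rα Rβ ++ productWith _⊙_ Rα Rβ
  merged [] rewrite refinements-[nd] k = begin
    productWith _++_ (splits (suc (k ℕ.+ j))) Rys
      ↭⟨ productWith-↭ˡ _++_ Rys (splits-⊙ k j) ⟩
    productWith _++_ (productWith _++_ (splits k) (splits j) ++ productWith _⊙_ (splits k) (splits j)) Rys
      ≡⟨ productWith-++ˡ _++_ (productWith _++_ (splits k) (splits j)) _ Rys ⟩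
    productWith _++_ (productWith _++_ (splits k) (splits j)) Rys ++ productWith _++_ (productWith _⊙_ (splits k) (splits j)) Rys
      ≡⟨ cong₂ _++_ (productWith-assoc (splits k) Rys (All.universal (λ t s r → ++-assoc s t r) _))
                    (productWith-assoc (splits k) Rys (All.map (λ { (startsND a t) s r → ⊙-++ s r (nonEmpty (nd a) t) })
                                                               (splits-startsND j))) ⟩
    productWith _++_ (splits k) Rβ ++ productWith _⊙_ (splits k) Rβ ∎
  merged (e ∷ xs) = begin
    refinements (e ∷ xs ++ nd (suc (k ℕ.+ j)) ∷ ys)
      ≡⟨ refinements-∷ e _ ⟩
    productWith _++_ E (refinements (xs ++ nd (suc (k ℕ.+ j)) ∷ ys))
      ↭⟨ productWith-↭ʳ _++_ E (merged xs) ⟩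
    productWith _++_ E (productWith _++_ Rα Rβ ++ productWith _⊙_ Rα Rβ)
      ↭⟨ productWith-++ʳ _++_ E (productWith _++_ Rα Rβ) _ ⟩
    productWith _++_ E (productWith _++_ Rα Rβ) ++ productWith _++_ E (productWith _⊙_ Rα Rβ)
      ≡⟨ cong₂ _++_ (productWith-assoc E Rβ (All.universal (λ t s r → ++-assoc s t r) _))
                    (productWith-assoc E Rβ (All.map (λ ends s r → ++-⊙ s r (endsND⇒nonEmpty ends))
                                                     (refinements-endsND xs k))) ⟨
    productWith _++_ (productWith _++_ E Rα) Rβ ++ productWith _⊙_ (productWith _++_ E Rα) Rβ
      ≡⟨ cong (λ R → productWith _++_ R Rβ ++ productWith _⊙_ R Rβ) (refinements-∷ e (xs ∷ʳ nd k)) ⟨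
    productWith _++_ (refinements (e ∷ xs ∷ʳ nd k)) Rβ ++ productWith _⊙_ (refinements (e ∷ xs ∷ʳ nd k)) Rβ ∎
    where
    E Rα : List DComp
    E = entryRefinements e
    Rα = refinements (xs ∷ʳ nd k)

grow-fibre : ∀ {x y b} → StartsND x → StartsND y → b ∈ grow x → b ∈ grow y → x ≡ y
grow-fibre _ _ (here p) (here p′) = ∷-injectiveʳ (≡.trans (≡.sym p) p′)
grow-fibre _ (startsND _ _) (here refl) (there (here ()))
grow-fibre (startsND _ _) _ (there (here refl)) (here ())
grow-fibre (startsND _ _) (startsND _ _) (there (here refl)) (there (here p′)) with ∷-injective p′
... | refl , refl = refl

splits-unique : ∀ k → Unique (splits k)
splits-unique zero = [] ∷ []
splits-unique (suc k) = unique-concatMap grow (splits-unique k) (All.map grow-unique (splits-startsND k))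
  (λ x∈ y∈ → grow-fibre (All.lookup (splits-startsND k) x∈) (All.lookup (splits-startsND k) y∈))
  where
  grow-unique : ∀ {c} → StartsND c → Unique (grow c)
  grow-unique (startsND a c) = ((λ ()) ∷ []) ∷ [] ∷ []

splits-prefixFree : ∀ k → PrefixFree (splits k)
splits-prefixFree zero (here refl) (here refl) t t′ eq = refl
splits-prefixFree (suc k) s∈ s′∈ t t′ eq
  with find (∈-concatMap⁻ grow s∈) | find (∈-concatMap⁻ grow s′∈)
... | c , c∈ , m | c′ , c′∈ , m′ = from-grow (All.lookup (splits-startsND k) c∈) (All.lookup (splits-startsND k) c′∈) m m′ eq
  where
  from-grow : ∀ {s s′} → StartsND c → StartsND c′ → s ∈ grow c → s′ ∈ grow c′ → s ++ t ≡ s′ ++ t′ → s ≡ s′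
  from-grow _ _ (here refl) (here refl) e = cong (nd 0 ∷_) (splits-prefixFree k c∈ c′∈ t t′ (∷-injectiveʳ e))
  from-grow _ (startsND _ _) (here refl) (there (here refl)) ()
  from-grow (startsND _ _) _ (there (here refl)) (here refl) ()
  from-grow (startsND a u) (startsND a′ u′) (there (here refl)) (there (here refl)) e with ∷-injective e
  ... | refl , e′ with splits-prefixFree k c∈ c′∈ t t′ (cong (nd a ∷_) e′)
  ... | refl = refl

refinements-unique : ∀ α → Unique (refinements α)
refinements-unique [] = [] ∷ []
refinements-unique (e ∷ r) rewrite refinements-∷ e r =
  unique-productWith-++ (entry-unique e) (entry-prefixFree e) (refinements-unique r)
  where
  entry-unique : ∀ e → Unique (entryRefinements e)
  entry-unique (nd k) = splits-unique k
  entry-unique (dt k) = [] ∷ []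
  entry-prefixFree : ∀ e → PrefixFree (entryRefinements e)
  entry-prefixFree (nd k) = splits-prefixFree k
  entry-prefixFree (dt k) (here refl) (here refl) _ _ _ = refl

-- Coarsenings

prependOrMerge : Entry → DComp → List DComp
prependOrMerge e c = (e ∷ c) ∷ mergeHead e c

coarsenings-nonEmpty : ∀ {α} → NonEmpty α → All NonEmpty (coarsenings α)
coarsenings-nonEmpty (nonEmpty e r) =
  All-concatMap⁺ (λ {c} _ → nonEmpty e c ∷ mergeHead-nonEmpty c) (All.universal (λ _ → tt) (coarsenings r))
  where
  mergeHead-nonEmpty : ∀ c → All NonEmpty (mergeHead e c)
  mergeHead-nonEmpty [] = []
  mergeHead-nonEmpty (f ∷ c) with addE e f
  ... | just g = nonEmpty g c ∷ []
  ... | nothing = []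

prependOrMerge-productWith : ∀ e {c} (cs : List DComp) → NonEmpty c →
  concatMap (λ c′ → prependOrMerge e (c ++ c′)) cs ↭ productWith _++_ (prependOrMerge e c) cs
prependOrMerge-productWith e cs (nonEmpty f c) =
  ↭-trans (concatMap-∷-↭ (λ c′ → e ∷ f ∷ c ++ c′) (λ c′ → mergeHead e (f ∷ c ++ c′)) cs)
    (↭-reflexive (cong (map (λ c′ → e ∷ f ∷ c ++ c′) cs ++_) mergeHead-++))
  where
  mergeHead-++ : concatMap (λ c′ → mergeHead e (f ∷ c ++ c′)) cs ≡ productWith _++_ (mergeHead e (f ∷ c)) cs
  mergeHead-++ with addE e f
  ... | just g = ≡.trans (concatMap-[ (λ c′ → g ∷ c ++ c′) ] cs) (≡.sym (++-identityʳ _))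
  ... | nothing = concatMap-const-[] cs

mergeHead-coarsenings : ∀ p q ys →
  concatMap (mergeHead (nd p)) (coarsenings (nd q ∷ ys)) ≡ coarsenings (nd (suc (p ℕ.+ q)) ∷ ys)
mergeHead-coarsenings p q ys = ≡.trans
  (concatMap-concatMap (mergeHead (nd p)) (prependOrMerge (nd q)) (coarsenings ys))
  (concatMap-cong merge-twice (coarsenings ys))
  where
  +-reassoc : ∀ r → p ℕ.+ suc (q ℕ.+ r) ≡ suc (p ℕ.+ q) ℕ.+ r
  +-reassoc r = ≡.trans (ℕ.+-suc p (q ℕ.+ r)) (cong suc (≡.sym (ℕ.+-assoc p q r)))
  merge-twice : ∀ c → concatMap (mergeHead (nd p)) (prependOrMerge (nd q) c) ≡ prependOrMerge (nd (suc (p ℕ.+ q))) c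
  merge-twice [] = refl
  merge-twice (nd r ∷ c) = cong (λ n → (nd (suc (p ℕ.+ q)) ∷ nd r ∷ c) ∷ (nd (suc n) ∷ c) ∷ []) (+-reassoc r)
  merge-twice (dt r ∷ c) = cong (λ n → (nd (suc (p ℕ.+ q)) ∷ dt r ∷ c) ∷ (dt (suc n) ∷ c) ∷ []) (+-reassoc r)

coarsenings-merge : ∀ xs p q ys →
  coarsenings (xs ++ nd p ∷ nd q ∷ ys) ↭
  productWith _++_ (coarsenings (xs ∷ʳ nd p)) (coarsenings (nd q ∷ ys)) ++ coarsenings (xs ++ nd (suc (p ℕ.+ q)) ∷ ys)
coarsenings-merge [] p q ys = ↭-trans
  (concatMap-∷-↭ (nd p ∷_) (mergeHead (nd p)) (coarsenings (nd q ∷ ys)))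
  (↭-reflexive (cong₂ _++_ (≡.sym (++-identityʳ _)) (mergeHead-coarsenings p q ys)))
coarsenings-merge (e ∷ xs) p q ys = begin
  concatMap (prependOrMerge e) (coarsenings (xs ++ nd p ∷ nd q ∷ ys))
    ↭⟨ concatMap-↭ (prependOrMerge e) (coarsenings-merge xs p q ys) ⟩
  concatMap (prependOrMerge e) (productWith _++_ Cα Cβ ++ coarsenings (xs ++ nd (suc (p ℕ.+ q)) ∷ ys))
    ≡⟨ concatMap-++ (prependOrMerge e) (productWith _++_ Cα Cβ) _ ⟩
  concatMap (prependOrMerge e) (productWith _++_ Cα Cβ) ++ coarsenings (e ∷ xs ++ nd (suc (p ℕ.+ q)) ∷ ys)
    ↭⟨ ++⁺ʳ _ (concatMap-productWith (prependOrMerge e) _++_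
                 (All.map (prependOrMerge-productWith e Cβ) (coarsenings-nonEmpty (endsND⇒nonEmpty (endsND xs p))))) ⟩
  productWith _++_ (coarsenings (e ∷ xs ∷ʳ nd p)) Cβ ++ coarsenings (e ∷ xs ++ nd (suc (p ℕ.+ q)) ∷ ys) ∎
  where
  open PermutationReasoning
  Cα Cβ : List DComp
  Cα = coarsenings (xs ∷ʳ nd p)
  Cβ = coarsenings (nd q ∷ ys)

data MergedHead (e : Entry) : DComp → DComp → Set where
  mergedHead : ∀ {f g} c → addE e f ≡ just g → MergedHead e (f ∷ c) (g ∷ c)

∈-mergeHead⁻ : ∀ e c {b} → b ∈ mergeHead e c → MergedHead e c b
∈-mergeHead⁻ e (f ∷ c) b∈ with addE e f in eq
∈-mergeHead⁻ e (f ∷ c) (here refl) | just g = mergedHead c eq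

addE-≢ : ∀ e {f g} → addE e f ≡ just g → e ≢ g
addE-≢ (nd a) {nd b} refl eq = ℕ.m≢1+m+n a (nd-inj eq)
addE-≢ (nd a) {dt b} refl ()
addE-≢ (dt a) {nd b} refl eq = ℕ.m+1+n≢m a (≡.sym (dt-inj eq))

addE-cancelˡ : ∀ e {f f′ g} → addE e f ≡ just g → addE e f′ ≡ just g → f ≡ f′
addE-cancelˡ (nd a) {nd b} {nd b′} refl eq = cong nd (ℕ.+-cancelˡ-≡ a b b′ (ℕ.suc-injective (nd-inj (just-injective (≡.sym eq)))))
addE-cancelˡ (nd a) {dt b} {dt b′} refl eq = cong dt (ℕ.+-cancelˡ-≡ (suc a) b b′ (dt-inj (just-injective (≡.sym eq))))
addE-cancelˡ (dt a) {nd b} {nd b′} refl eq =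
  cong nd (ℕ.suc-injective (ℕ.+-cancelˡ-≡ a (suc b) (suc b′) (dt-inj (just-injective (≡.sym eq)))))
addE-cancelˡ (nd a) {nd b} {dt b′} refl ()
addE-cancelˡ (nd a) {dt b} {nd b′} refl ()
addE-cancelˡ (dt a) {nd b} {dt b′} refl ()

prependOrMerge-unique : ∀ e c → Unique (prependOrMerge e c)
prependOrMerge-unique e c = All.tabulate prepended≢merged ∷ mergeHead-unique c
  where
  prepended≢merged : ∀ {b} → b ∈ mergeHead e c → e ∷ c ≢ b
  prepended≢merged b∈ eq with ∈-mergeHead⁻ e c b∈
  ... | mergedHead c′ ad = addE-≢ e ad (proj₁ (∷-injective eq))
  mergeHead-unique : ∀ c → Unique (mergeHead e c)
  mergeHead-unique [] = []
  mergeHead-unique (f ∷ c) with addE e f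
  ... | just g = [] ∷ []
  ... | nothing = []

prependOrMerge-fibre : ∀ e {x y b} → b ∈ prependOrMerge e x → b ∈ prependOrMerge e y → x ≡ y
prependOrMerge-fibre e (here p) (here p′) = ∷-injectiveʳ (≡.trans (≡.sym p) p′)
prependOrMerge-fibre e {y = y} (here refl) (there b∈) with ∈-mergeHead⁻ e y b∈
... | mergedHead c ad = ⊥-elim (addE-≢ e ad refl)
prependOrMerge-fibre e {x} (there b∈) (here refl) with ∈-mergeHead⁻ e x b∈
... | mergedHead c ad = ⊥-elim (addE-≢ e ad refl)
prependOrMerge-fibre e {x} {y} (there b∈) (there b∈′) with ∈-mergeHead⁻ e x b∈ | ∈-mergeHead⁻ e y b∈′
... | mergedHead c ad | mergedHead c ad′ = cong (_∷ c) (addE-cancelˡ e ad ad′)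

coarsenings-unique : ∀ α → Unique (coarsenings α)
coarsenings-unique [] = [] ∷ []
coarsenings-unique (e ∷ r) = unique-concatMap (prependOrMerge e) (coarsenings-unique r)
  (All.universal (prependOrMerge-unique e) (coarsenings r)) (λ _ _ → prependOrMerge-fibre e)

-- Coefficients

coeff-++ : ∀ γ x y → coeff γ (x ++ y) ≡ coeff γ x + coeff γ y
coeff-++ γ [] y = ≡.sym (ℤ.+-identityˡ _)
coeff-++ γ ((c , δ) ∷ x) y with δ ≟D γ
... | yes _ = ≡.trans (cong (c +_) (coeff-++ γ x y)) (≡.sym (ℤ.+-assoc c _ _))
... | no _ = coeff-++ γ x y

coeff-↭ : ∀ γ {x y} → x ↭ y → coeff γ x ≡ coeff γ y
coeff-↭ γ refl = refl
coeff-↭ γ {_ ∷ x} {_ ∷ y} (prep p q) = begin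
  coeff γ (p ∷ x)             ≡⟨ coeff-++ γ [ p ] x ⟩
  coeff γ [ p ] + coeff γ x   ≡⟨ cong (coeff γ [ p ] +_) (coeff-↭ γ q) ⟩
  coeff γ [ p ] + coeff γ y   ≡⟨ coeff-++ γ [ p ] y ⟨
  coeff γ (p ∷ y)             ∎
  where open ≡-Reasoning
coeff-↭ γ {_ ∷ _ ∷ x} {_ ∷ _ ∷ y} (swap p p′ q) = begin
  coeff γ (p ∷ p′ ∷ x)
    ≡⟨ ≡.trans (coeff-++ γ [ p ] _) (cong (coeff γ [ p ] +_) (coeff-++ γ [ p′ ] x)) ⟩
  coeff γ [ p ] + (coeff γ [ p′ ] + coeff γ x)
    ≡⟨ cong (λ z → coeff γ [ p ] + (coeff γ [ p′ ] + z)) (coeff-↭ γ q) ⟩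
  coeff γ [ p ] + (coeff γ [ p′ ] + coeff γ y)
    ≡⟨ x∙yz≈y∙xz (coeff γ [ p ]) (coeff γ [ p′ ]) (coeff γ y) ⟩
  coeff γ [ p′ ] + (coeff γ [ p ] + coeff γ y)
    ≡⟨ ≡.trans (coeff-++ γ [ p′ ] _) (cong (coeff γ [ p′ ] +_) (coeff-++ γ [ p ] y)) ⟨
  coeff γ (p′ ∷ p ∷ y) ∎
  where open ≡-Reasoning
coeff-↭ γ (trans p q) = ≡.trans (coeff-↭ γ p) (coeff-↭ γ q)

≈-setoid : Setoid 0ℓ 0ℓ
≈-setoid = record
  { Carrier = SQSym
  ; _≈_ = _≈_
  ; isEquivalence = record
    { refl = λ _ → refl
    ; sym = λ p γ → ≡.sym (p γ)
    ; trans = λ p q γ → ≡.trans (p γ) (q γ)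
    }
  }

↭⇒≈ : ∀ {x y} → x ↭ y → x ≈ y
↭⇒≈ p γ = coeff-↭ γ p

++-cong-≈ : ∀ {x x′ y y′} → x ≈ x′ → y ≈ y′ → x ++ y ≈ x′ ++ y′
++-cong-≈ {x} {x′} {y} {y′} p q γ =
  ≡.trans (coeff-++ γ x y) (≡.trans (cong₂ _+_ (p γ) (q γ)) (≡.sym (coeff-++ γ x′ y′)))

concatMap-cong-≈ : ∀ {A : Set} {f g : A → SQSym} (xs : List A) → All (λ x → f x ≈ g x) xs → concatMap f xs ≈ concatMap g xs
concatMap-cong-≈ [] [] _ = refl
concatMap-cong-≈ {f = f} {g} (x ∷ xs) (p ∷ ps) =
  ++-cong-≈ {f x} {g x} {concatMap f xs} {concatMap g xs} p (concatMap-cong-≈ xs ps)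

infix 8 _·_
_·_ : ℤ → List DComp → SQSym
c · δs = map (c ,_) δs

coeff-· : ∀ γ c δs → coeff γ (c · δs) ≡ c ℤ.* coeff γ (1ℤ · δs)
coeff-· γ c [] = ≡.sym (ℤ.*-zeroʳ c)
coeff-· γ c (δ ∷ δs) with δ ≟D γ
... | yes _ = begin
  c + coeff γ (c · δs)                    ≡⟨ cong₂ _+_ (≡.sym (ℤ.*-identityʳ c)) (coeff-· γ c δs) ⟩
  c ℤ.* 1ℤ + c ℤ.* coeff γ (1ℤ · δs)      ≡⟨ ℤ.*-distribˡ-+ c 1ℤ _ ⟨
  c ℤ.* (1ℤ + coeff γ (1ℤ · δs))          ∎
  where open ≡-Reasoning
... | no _ = coeff-· γ c δs

·-cancel : ∀ c δs → (-1ℤ ℤ.* c) · δs ++ c · δs ≈ []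
·-cancel c δs γ = begin
  coeff γ ((-1ℤ ℤ.* c) · δs ++ c · δs)                 ≡⟨ coeff-++ γ ((-1ℤ ℤ.* c) · δs) _ ⟩
  coeff γ ((-1ℤ ℤ.* c) · δs) + coeff γ (c · δs)      ≡⟨ cong₂ _+_ (coeff-· γ (-1ℤ ℤ.* c) δs) (coeff-· γ c δs) ⟩
  -1ℤ ℤ.* c ℤ.* n + c ℤ.* n                          ≡⟨ negation-cancels c n ⟩
  0ℤ                                                   ∎
  where
  open ≡-Reasoning
  n : ℤ
  n = coeff γ (1ℤ · δs)
  negation-cancels : ∀ c n → -1ℤ ℤ.* c ℤ.* n + c ℤ.* n ≡ 0ℤ
  negation-cancels = solve-∀

scale-· : ∀ a c δs → scale a (c · δs) ≡ (a ℤ.* c) · δs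
scale-· a c δs = ≡.sym (map-∘ δs)

·-•-· : ∀ c d δs εs → (c · δs) • (d · εs) ≡ (c ℤ.* d) · productWith _++_ δs εs
·-•-· c d [] εs = refl
·-•-· c d (δ ∷ δs) εs = begin
  (c · (δ ∷ δs)) • (d · εs)
    ≡⟨ cong₂ _++_ (≡.sym (map-∘ εs)) (·-•-· c d δs εs) ⟩
  map (λ ε → (c ℤ.* d , δ ++ ε)) εs ++ (c ℤ.* d) · productWith _++_ δs εs
    ≡⟨ cong (_++ (c ℤ.* d) · productWith _++_ δs εs) (map-∘ εs) ⟩
  (c ℤ.* d) · map (δ ++_) εs ++ (c ℤ.* d) · productWith _++_ δs εs
    ≡⟨ map-++ (c ℤ.* d ,_) (map (δ ++_) εs) _ ⟨
  (c ℤ.* d) · productWith _++_ (δ ∷ δs) εs ∎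
  where open ≡-Reasoning

•-[] : ∀ x → x • [] ≡ []
•-[] [] = refl
•-[] (_ ∷ x) = •-[] x

•-++ʳ : ∀ x y z → x • (y ++ z) ↭ x • y ++ x • z
•-++ʳ [] y z = ↭-refl
•-++ʳ ((c , δ) ∷ x) y z = begin
  map h (y ++ z) ++ x • (y ++ z)          ↭⟨ ++⁺ (↭-reflexive (map-++ h y z)) (•-++ʳ x y z) ⟩
  (map h y ++ map h z) ++ x • y ++ x • z  ≡⟨ ++-assoc (map h y) _ _ ⟩
  map h y ++ map h z ++ x • y ++ x • z    ↭⟨ ++⁺ˡ (map h y) (shifts (map h z) (x • y)) ⟩
  map h y ++ x • y ++ map h z ++ x • z    ≡⟨ ++-assoc (map h y) _ _ ⟨
  (map h y ++ x • y) ++ map h z ++ x • z  ∎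
  where
  open PermutationReasoning
  h : ℤ × DComp → ℤ × DComp
  h (b , ε) = (c ℤ.* b , δ ++ ε)

•-concatMapʳ : ∀ {A : Set} x (g : A → SQSym) (ys : List A) → x • concatMap g ys ↭ concatMap (λ y → x • g y) ys
•-concatMapʳ x g [] = ↭-reflexive (•-[] x)
•-concatMapʳ x g (y ∷ ys) = ↭-trans (•-++ʳ x (g y) (concatMap g ys)) (++⁺ˡ (x • g y) (•-concatMapʳ x g ys))

scale-•-concatMap : ∀ {A B : Set} σ (f : A → SQSym) (g : B → SQSym) (xs : List A) (ys : List B) →
  scale σ (concatMap f xs • concatMap g ys) ↭ concatMap (λ y → concatMap (λ x → scale σ (f x • g y)) xs) ys
scale-•-concatMap σ f g xs ys = begin
  scale σ (concatMap f xs • concatMap g ys)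
    ≡⟨ cong (scale σ) (concatMap-concatMap _ f xs) ⟩
  scale σ (concatMap (λ x → f x • concatMap g ys) xs)
    ↭⟨ map⁺ _ (concatMap-cong-↭ xs (All.universal (λ x → •-concatMapʳ (f x) g ys) xs)) ⟩
  scale σ (concatMap (λ x → concatMap (λ y → f x • g y) ys) xs)
    ↭⟨ map⁺ _ (concatMap-comm (λ x y → f x • g y) xs ys) ⟩
  scale σ (concatMap (λ y → concatMap (λ x → f x • g y) xs) ys)
    ≡⟨ ≡.trans (map-concatMap _ _ ys) (concatMap-cong (λ y → map-concatMap _ _ xs) ys) ⟩
  concatMap (λ y → concatMap (λ x → scale σ (f x • g y)) xs) ys ∎
  where open PermutationReasoning

-- The antipode on L

sign : DComp → ℤ
sign α = sgn (length α ℕ.+ (fdeg α C 2))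

antipodeM : DComp → SQSym
antipodeM β = sign β · coarsenings (reverse β)

S-L : ∀ α → S (L α) ≡ concatMap antipodeM (refinements α)
S-L α = begin
  S (L α)                                             ≡⟨ cong (λ βs → S (1ℤ · βs)) (deduplicate-unique _≟D_ (refinements-unique α)) ⟩
  S (1ℤ · refinements α)                              ≡⟨ S-· (refinements α) ⟩
  concatMap (λ β → scale 1ℤ (SM β)) (refinements α)   ≡⟨ concatMap-cong S-M (refinements α) ⟩
  concatMap antipodeM (refinements α)                 ∎
  where
  open ≡-Reasoning
  S-· : ∀ βs → S (1ℤ · βs) ≡ concatMap (λ β → scale 1ℤ (SM β)) βs
  S-· [] = refl
  S-· (β ∷ βs) = cong (scale 1ℤ (SM β) ++_) (S-· βs)
  S-M : ∀ β → scale 1ℤ (SM β) ≡ antipodeM β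
  S-M β = ≡.trans (scale-· 1ℤ (sign β) (aboveT (reverse β)))
    (cong₂ _·_ (ℤ.*-identityˡ (sign β)) (deduplicate-unique _≟D_ (coarsenings-unique (reverse β))))

C2-+ : ∀ a b → (a ℕ.+ b) C 2 ≡ a C 2 ℕ.+ b C 2 ℕ.+ a * b
C2-+ zero b = ≡.sym (ℕ.+-identityʳ (b C 2))
C2-+ (suc a) b = begin
  suc (a ℕ.+ b) C 2                               ≡⟨ nCk+nC[k+1]≡[n+1]C[k+1] (a ℕ.+ b) 1 ⟨
  (a ℕ.+ b) C 1 ℕ.+ (a ℕ.+ b) C 2                 ≡⟨ cong₂ ℕ._+_ (nC1≡n (a ℕ.+ b)) (C2-+ a b) ⟩
  (a ℕ.+ b) ℕ.+ (a C 2 ℕ.+ b C 2 ℕ.+ a * b)       ≡⟨ rearrange a b (a C 2) (b C 2) ⟩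
  (a ℕ.+ a C 2) ℕ.+ b C 2 ℕ.+ suc a * b           ≡⟨ cong (λ z → z ℕ.+ b C 2 ℕ.+ suc a * b)
                                                        (≡.trans (cong (ℕ._+ a C 2) (≡.sym (nC1≡n a))) (nCk+nC[k+1]≡[n+1]C[k+1] a 1)) ⟩
  suc a C 2 ℕ.+ b C 2 ℕ.+ suc a * b               ∎
  where
  open ≡-Reasoning
  rearrange : ∀ a b ca cb → (a ℕ.+ b) ℕ.+ (ca ℕ.+ cb ℕ.+ a * b) ≡ (a ℕ.+ ca) ℕ.+ cb ℕ.+ suc a * b
  rearrange = ℕ-Solver.solve-∀

sgn-+ : ∀ m n → sgn (m ℕ.+ n) ≡ sgn m ℤ.* sgn n
sgn-+ = ℤ.^-distribˡ-+-* -1ℤ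

sign-++ : ∀ a b → sign (a ++ b) ≡ sgn (fdeg a * fdeg b) ℤ.* (sign b ℤ.* sign a)
sign-++ a b = begin
  sgn (length (a ++ b) ℕ.+ fdeg (a ++ b) C 2)
    ≡⟨ cong₂ (λ l m → sgn (l ℕ.+ m C 2)) (length-++ a) (fdeg-++ a b) ⟩
  sgn ((la ℕ.+ lb) ℕ.+ (ma ℕ.+ mb) C 2)
    ≡⟨ cong (λ z → sgn ((la ℕ.+ lb) ℕ.+ z)) (C2-+ ma mb) ⟩
  sgn ((la ℕ.+ lb) ℕ.+ (ma C 2 ℕ.+ mb C 2 ℕ.+ ma * mb))
    ≡⟨ cong sgn (rearrange la lb (ma C 2) (mb C 2) (ma * mb)) ⟩
  sgn (ma * mb ℕ.+ ((lb ℕ.+ mb C 2) ℕ.+ (la ℕ.+ ma C 2)))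
    ≡⟨ ≡.trans (sgn-+ (ma * mb) _) (cong (sgn (ma * mb) ℤ.*_) (sgn-+ (lb ℕ.+ mb C 2) _)) ⟩
  sgn (ma * mb) ℤ.* (sign b ℤ.* sign a) ∎
  where
  open ≡-Reasoning
  la lb ma mb : ℕ
  la = length a
  lb = length b
  ma = fdeg a
  mb = fdeg b
  rearrange : ∀ la lb ca cb m → (la ℕ.+ lb) ℕ.+ (ca ℕ.+ cb ℕ.+ m) ≡ m ℕ.+ ((lb ℕ.+ cb) ℕ.+ (la ℕ.+ ca))
  rearrange = ℕ-Solver.solve-∀

sign-⊙ : ∀ {a b} → EndsND a → StartsND b → sign (a ++ b) ≡ -1ℤ ℤ.* sign (a ⊙ b)
sign-⊙ (endsND xs p) (startsND q ys) rewrite ⊙-nd xs p q ys | ++-assoc xs [ nd p ] (nd q ∷ ys) =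
  cong₂ (λ l m → sgn (l ℕ.+ m C 2))
    (≡.trans (length-++-sucʳ xs (nd p) (nd q ∷ ys)) (cong suc (≡.trans (length-++ xs) (≡.sym (length-++ xs)))))
    (≡.trans (fdeg-++ xs (nd p ∷ nd q ∷ ys)) (≡.sym (fdeg-++ xs (nd (suc (p ℕ.+ q)) ∷ ys))))

reverse-++-∷ : ∀ xs (e : Entry) ys → reverse (xs ++ e ∷ ys) ≡ reverse ys ++ e ∷ reverse xs
reverse-++-∷ xs e ys = ≡.trans (reverse-++ xs (e ∷ ys))
  (≡.trans (cong (_++ reverse xs) (unfold-reverse e ys)) (++-assoc (reverse ys) [ e ] (reverse xs)))

coarsenings-reverse-⊙ : ∀ {a b} → EndsND a → StartsND b →
  coarsenings (reverse (a ++ b)) ↭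
  productWith _++_ (coarsenings (reverse b)) (coarsenings (reverse a)) ++ coarsenings (reverse (a ⊙ b))
coarsenings-reverse-⊙ (endsND xs p) (startsND q ys)
  rewrite ⊙-nd xs p q ys | reverse-++-∷ (xs ∷ʳ nd p) (nd q) ys | reverse-++ xs [ nd p ] | unfold-reverse (nd q) ys
        | reverse-++-∷ xs (nd (suc (p ℕ.+ q))) ys | ℕ.+-comm p q =
  coarsenings-merge (reverse ys) q p (reverse xs)

antipodeM-⊙ : ∀ {a b} → EndsND a → StartsND b →
  antipodeM (a ++ b) ++ antipodeM (a ⊙ b) ≈ scale (sgn (fdeg a * fdeg b)) (antipodeM b • antipodeM a)
antipodeM-⊙ {a} {b} ea sb = begin
  sign (a ++ b) · coarsenings (reverse (a ++ b)) ++ sign m · Cm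
    ≈⟨ ↭⇒≈ (++⁺ʳ _ (map⁺ _ (coarsenings-reverse-⊙ ea sb))) ⟩
  sign (a ++ b) · (P ++ Cm) ++ sign m · Cm
    ≡⟨ ≡.trans (cong (_++ sign m · Cm) (map-++ _ P Cm)) (++-assoc (sign (a ++ b) · P) _ _) ⟩
  sign (a ++ b) · P ++ (sign (a ++ b) · Cm ++ sign m · Cm)
    ≡⟨ cong (λ s → sign (a ++ b) · P ++ (s · Cm ++ sign m · Cm)) (sign-⊙ ea sb) ⟩
  sign (a ++ b) · P ++ ((-1ℤ ℤ.* sign m) · Cm ++ sign m · Cm)
    ≈⟨ ++-cong-≈ {sign (a ++ b) · P} {sign (a ++ b) · P} (λ _ → refl) (·-cancel (sign m) Cm) ⟩
  sign (a ++ b) · P ++ []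
    ≡⟨ ≡.trans (++-identityʳ _) (cong (_· P) (sign-++ a b)) ⟩
  (σ ℤ.* (sign b ℤ.* sign a)) · P
    ≡⟨ ≡.trans (cong (scale σ) (·-•-· (sign b) (sign a) (coarsenings (reverse b)) (coarsenings (reverse a)))) (scale-· σ _ P) ⟨
  scale σ (antipodeM b • antipodeM a) ∎
  where
  open SetoidReasoning ≈-setoid
  m : DComp
  m = a ⊙ b
  Cm P : List DComp
  Cm = coarsenings (reverse m)
  P = productWith _++_ (coarsenings (reverse b)) (coarsenings (reverse a))
  σ : ℤ
  σ = sgn (fdeg a * fdeg b)

mainTheorem5 : (α₀ : DComp) (k j : ℕ) (β₀ : DComp) →
    let α = α₀ ∷ʳ nd k
        β = nd j ∷ β₀
    in S (L (α ⊙ β)) ≈ scale (sgn (fdeg α * fdeg β)) (S (L β) • S (L α))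
mainTheorem5 α₀ k j β₀ = begin
  S (L (α ⊙ β))
    ≡⟨ S-L (α ⊙ β) ⟩
  concatMap antipodeM (refinements (α ⊙ β))
    ≈⟨ ↭⇒≈ (concatMap-↭ antipodeM (refinements-⊙ α₀ k j β₀)) ⟩
  concatMap antipodeM (productWith _++_ Rα Rβ ++ productWith _⊙_ Rα Rβ)
    ≈⟨ ↭⇒≈ (concatMap-productWith-++ antipodeM _++_ _⊙_ Rα Rβ) ⟩
  concatMap (λ a → concatMap (λ b → antipodeM (a ++ b) ++ antipodeM (a ⊙ b)) Rβ) Rα
    ≈⟨ concatMap-cong-≈ Rα (All.map (λ (ea , fa) → concatMap-cong-≈ Rβ (All.map (λ (sb , fb) → pair ea fa sb fb) Rβ-props)) Rα-props) ⟩
  concatMap (λ a → concatMap (λ b → scale σ (antipodeM b • antipodeM a)) Rβ) Rα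
    ≈⟨ ↭⇒≈ (scale-•-concatMap σ antipodeM antipodeM Rβ Rα) ⟨
  scale σ (concatMap antipodeM Rβ • concatMap antipodeM Rα)
    ≡⟨ cong (scale σ) (cong₂ _•_ (S-L β) (S-L α)) ⟨
  scale σ (S (L β) • S (L α)) ∎
  where
  open SetoidReasoning ≈-setoid
  α β : DComp
  α = α₀ ∷ʳ nd k
  β = nd j ∷ β₀
  Rα Rβ : List DComp
  Rα = refinements α
  Rβ = refinements β
  σ : ℤ
  σ = sgn (fdeg α * fdeg β)
  Rα-props : All (λ a → EndsND a × fdeg a ≡ fdeg α) Rα
  Rα-props = All.zip (refinements-endsND α₀ k , refinements-fdeg α)
  Rβ-props : All (λ b → StartsND b × fdeg b ≡ fdeg β) Rβ
  Rβ-props = All.zip (refinements-startsND j β₀ , refinements-fdeg β)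
  pair : ∀ {a b} → EndsND a → fdeg a ≡ fdeg α → StartsND b → fdeg b ≡ fdeg β →
    antipodeM (a ++ b) ++ antipodeM (a ⊙ b) ≈ scale σ (antipodeM b • antipodeM a)
  pair ea fa sb fb rewrite ≡.sym fa | ≡.sym fb = antipodeM-⊙ ea sb
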